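{- Let $n\in\mathbb N$ (positive integer). The system \[ a_i+2b_i+3c_i=n \ \text{ for } i\in\{1,\dots,n^2\},\qquad \sum_{i=1}^{n^2}a_i=n,\qquad \sum_{i=1}^{n^2}b_i=3\binom{n}{2},\qquad \sum_{i=1}^{n^2}c_i=2\binom{n}{3} \] has a solution in nonnegative integers $a_i,b_i,c_i$ ($1\le i\le n^2$) if and only if either $n=1$, or $n\equiv 0,2\pmod 3$ and $n\neq 3$. -}

module Defs where

open import Data.Nat using (ℕ; zero; suc; _+_; _*_)
open import Data.Fin using (Fin)
open import Data.Vec.Functional using (Vector; foldr)

sumFin : ∀ {m} → (Fin m → ℕ) → ℕ
sumFin f = foldr _+_ 0 f

-- If n ≡ 1 (mod 3), a row with a = 0 needs b ≥ 2 (b = 0 or b = 1 would make n ≡ 0 or 2),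
-- so every row has b + 2a ≥ 2; summing over the n² rows gives 2n² ≤ 3·C(n,2) + 2n, i.e.
-- n² ≤ n. For n = 3 every row has b ≤ a, contradicting Σb = 9 > 3 = Σa.
-- Conversely, n rows with a = 1 carry the first column, and two row types with a = 0 fill
-- the remaining n² − n rows in the proportion dictated by the second column. The third
-- column then comes for free: Σa + 2Σb + 3Σc = n · n², and n³ = n + 6·C(n,2) + 6·C(n,3).
module Submission where

open import Defs
open import Data.Nat
  using (ℕ; zero; suc; _+_; _*_; NonZero; _%_; _/_; _≤_; _<_; z≤n; s≤s; ≢-nonZero⁻¹; >-nonZero⁻¹)
open import Data.Nat.Properties
open import Data.Nat.DivMod using (m≡m%n+[m/n]*n; m%n<n; [m+kn]%n≡m%n)
open import Data.Nat.Combinatorics using (_C_; nCk+nC[k+1]≡[n+1]C[k+1]; nC1≡n)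
open import Data.Nat.ListAction using (sum)
open import Data.Nat.ListAction.Properties using (sum-++)
open import Data.Nat.Tactic.RingSolver using (solve; solve-∀)
open import Algebra.Properties.Semiring.Sum +-*-semiring using (∑-distrib-+; *-distribˡ-sum)
open import Algebra.Properties.CommutativeSemigroup *-commutativeSemigroup using (x∙yz≈y∙xz)
open import Data.Fin using (Fin; zero; suc)
open import Data.List using (List; []; _∷_; _++_; map; replicate; length; lookup)
open import Data.List.Properties using (length-++; length-replicate; map-++; map-replicate)
open import Data.List.Relation.Unary.All as All using (All)
open import Data.List.Relation.Unary.All.Properties using (++⁺; replicate⁺)
open import Data.List.Membership.Propositional.Properties using (∈-lookup)
open import Data.Product using (Σ; _×_; _,_; proj₁; proj₂)
open import Data.Sum using (_⊎_; inj₁; inj₂)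
open import Data.Empty using (⊥-elim)
open import Function.Base using (_∘_)
open import Function.Bundles using (_⇔_; mk⇔)
open import Relation.Binary.PropositionalEquality
  using (_≡_; _≢_; refl; sym; trans; cong; cong₂; subst; subst₂; module ≡-Reasoning)

2*[1+m]C2≡[1+m]*m : ∀ m → 2 * (suc m C 2) ≡ suc m * m
2*[1+m]C2≡[1+m]*m zero = refl
2*[1+m]C2≡[1+m]*m (suc m) = begin
  2 * ((2 + m) C 2)                  ≡⟨ cong (2 *_) (nCk+nC[k+1]≡[n+1]C[k+1] (suc m) 1) ⟨
  2 * (suc m C 1 + suc m C 2)        ≡⟨ *-distribˡ-+ 2 (suc m C 1) _ ⟩
  2 * (suc m C 1) + 2 * (suc m C 2)  ≡⟨ cong₂ (λ p q → 2 * p + q) (nC1≡n (suc m)) (2*[1+m]C2≡[1+m]*m m) ⟩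
  2 * suc m + suc m * m              ≡⟨ solve (m ∷ []) ⟩
  (2 + m) * suc m                    ∎
  where open ≡-Reasoning

6*[2+m]C3≡[2+m]*[1+m]*m : ∀ m → 6 * ((2 + m) C 3) ≡ (2 + m) * suc m * m
6*[2+m]C3≡[2+m]*[1+m]*m zero = refl
6*[2+m]C3≡[2+m]*[1+m]*m (suc m) = begin
  6 * ((3 + m) C 3)                        ≡⟨ cong (6 *_) (nCk+nC[k+1]≡[n+1]C[k+1] (2 + m) 2) ⟨
  6 * ((2 + m) C 2 + (2 + m) C 3)          ≡⟨ *-distribˡ-+ 6 ((2 + m) C 2) _ ⟩
  6 * ((2 + m) C 2) + 6 * ((2 + m) C 3)    ≡⟨ cong (_+ 6 * ((2 + m) C 3)) (*-assoc 3 2 ((2 + m) C 2)) ⟩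
  3 * (2 * ((2 + m) C 2)) + 6 * ((2 + m) C 3)
    ≡⟨ cong₂ (λ p q → 3 * p + q) (2*[1+m]C2≡[1+m]*m (suc m)) (6*[2+m]C3≡[2+m]*[1+m]*m m) ⟩
  3 * ((2 + m) * suc m) + (2 + m) * suc m * m  ≡⟨ solve (m ∷ []) ⟩
  (3 + m) * (2 + m) * suc m                ∎
  where open ≡-Reasoning

n³≡n+6*nC2+6*nC3 : ∀ n → n * n * n ≡ n + 6 * (n C 2) + 6 * (n C 3)
n³≡n+6*nC2+6*nC3 0 = refl
n³≡n+6*nC2+6*nC3 1 = refl
n³≡n+6*nC2+6*nC3 (suc (suc m)) = begin
  (2 + m) * (2 + m) * (2 + m)                            ≡⟨ solve (m ∷ []) ⟩
  (2 + m) + 3 * ((2 + m) * suc m) + (2 + m) * suc m * m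
    ≡⟨ cong₂ (λ p q → 2 + m + 3 * p + q) (2*[1+m]C2≡[1+m]*m (suc m)) (6*[2+m]C3≡[2+m]*[1+m]*m m) ⟨
  (2 + m) + 3 * (2 * ((2 + m) C 2)) + 6 * ((2 + m) C 3)
    ≡⟨ cong (λ p → 2 + m + p + 6 * ((2 + m) C 3)) (*-assoc 3 2 ((2 + m) C 2)) ⟨
  (2 + m) + 6 * ((2 + m) C 2) + 6 * ((2 + m) C 3)        ∎
  where open ≡-Reasoning

2*X≡3*[1+m]*m⇒X≡3*[1+m]C2 : ∀ m X → 2 * X ≡ 3 * (suc m * m) → X ≡ 3 * (suc m C 2)
2*X≡3*[1+m]*m⇒X≡3*[1+m]C2 m X 2X≡ = *-cancelˡ-≡ X _ 2 (begin
  2 * X                  ≡⟨ 2X≡ ⟩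
  3 * (suc m * m)        ≡⟨ cong (3 *_) (2*[1+m]C2≡[1+m]*m m) ⟨
  3 * (2 * (suc m C 2))  ≡⟨ x∙yz≈y∙xz 3 2 (suc m C 2) ⟩
  2 * (3 * (suc m C 2))  ∎)
  where open ≡-Reasoning

sumFin-mono : ∀ {m} {f g : Fin m → ℕ} → (∀ i → f i ≤ g i) → sumFin f ≤ sumFin g
sumFin-mono {zero}  _   = z≤n
sumFin-mono {suc m} f≤g = +-mono-≤ (f≤g zero) (sumFin-mono (f≤g ∘ suc))

sumFin-const : ∀ m k → sumFin {m} (λ _ → k) ≡ m * k
sumFin-const zero    k = refl
sumFin-const (suc m) k = cong (k +_) (sumFin-const m k)

sumFin-lookup : ∀ {A : Set} (f : A → ℕ) (xs : List A) → sumFin (f ∘ lookup xs) ≡ sum (map f xs)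
sumFin-lookup f []       = refl
sumFin-lookup f (x ∷ xs) = cong (f x +_) (sumFin-lookup f xs)

sum-replicate : ∀ k x → sum (replicate k x) ≡ k * x
sum-replicate zero    x = refl
sum-replicate (suc k) x = cong (x +_) (sum-replicate k x)

Solution : ℕ → ℕ → Set
Solution n m = Σ (Fin m → ℕ) λ a → Σ (Fin m → ℕ) λ b → Σ (Fin m → ℕ) λ c →
  ((i : Fin m) → a i + 2 * b i + 3 * c i ≡ n)
  × sumFin a ≡ n
  × sumFin b ≡ 3 * (n C 2)
  × sumFin c ≡ 2 * (n C 3)

Solvable : ℕ → Set
Solvable n = Solution n (n * n)

Row : Set
Row = ℕ × ℕ × ℕ

col₁ col₂ col₃ : Row → ℕ
col₁ (a , _ , _) = a
col₂ (_ , b , _) = b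
col₃ (_ , _ , c) = c

Fits : ℕ → Row → Set
Fits n (a , b , c) = a + 2 * b + 3 * c ≡ n

[r+3c]%3≡r%3 : ∀ r c → (r + 3 * c) % 3 ≡ r % 3
[r+3c]%3≡r%3 r c = trans (cong (λ t → (r + t) % 3) (*-comm 3 c)) ([m+kn]%n≡m%n r c 3)

fits-1mod3⇒2≤b+2a : ∀ {n} a b c → n % 3 ≡ 1 → a + 2 * b + 3 * c ≡ n → 2 ≤ b + 2 * a
fits-1mod3⇒2≤b+2a (suc a) b             c _ _ = ≤-trans (*-monoʳ-≤ 2 (s≤s (z≤n {a}))) (m≤n+m _ b)
fits-1mod3⇒2≤b+2a zero    (suc (suc b)) c _ _ = s≤s (s≤s z≤n)
fits-1mod3⇒2≤b+2a zero    zero          c n%3≡1 fits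
  with trans (sym n%3≡1) (trans (cong (_% 3) (sym fits)) ([r+3c]%3≡r%3 0 c))
... | ()
fits-1mod3⇒2≤b+2a zero    (suc zero)    c n%3≡1 fits
  with trans (sym n%3≡1) (trans (cong (_% 3) (sym fits)) ([r+3c]%3≡r%3 2 c))
... | ()

n*n*2≤3*nC2+2*n⇒n≤1 : ∀ n → n * n * 2 ≤ 3 * (n C 2) + 2 * n → n ≤ 1
n*n*2≤3*nC2+2*n⇒n≤1 0 _ = z≤n
n*n*2≤3*nC2+2*n⇒n≤1 1 _ = ≤-refl
n*n*2≤3*nC2+2*n⇒n≤1 (suc (suc k)) le =
  ⊥-elim (m+1+n≰m (3 * ((2 + k) * suc k) + 4 * (2 + k)) (begin
  3 * ((2 + k) * suc k) + 4 * (2 + k) + (2 + k) * suc k  ≡⟨ solve (k ∷ []) ⟩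
  2 * ((2 + k) * (2 + k) * 2)                            ≤⟨ *-monoʳ-≤ 2 le ⟩
  2 * (3 * ((2 + k) C 2) + 2 * (2 + k))                  ≡⟨ *-distribˡ-+ 2 (3 * ((2 + k) C 2)) _ ⟩
  2 * (3 * ((2 + k) C 2)) + 2 * (2 * (2 + k))
    ≡⟨ cong₂ _+_ (x∙yz≈y∙xz 2 3 ((2 + k) C 2)) (sym (*-assoc 2 2 (2 + k))) ⟩
  3 * (2 * ((2 + k) C 2)) + 4 * (2 + k)
    ≡⟨ cong (λ p → 3 * p + 4 * (2 + k)) (2*[1+m]C2≡[1+m]*m (suc k)) ⟩
  3 * ((2 + k) * suc k) + 4 * (2 + k)                    ∎))
  where open ≤-Reasoning

solvable∧1mod3⇒n≤1 : ∀ n → n % 3 ≡ 1 → Solvable n → n ≤ 1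
solvable∧1mod3⇒n≤1 n n%3≡1 (a , b , c , fits , Σa≡n , Σb≡3C2 , _) =
  n*n*2≤3*nC2+2*n⇒n≤1 n (begin
  n * n * 2                          ≡⟨ sumFin-const (n * n) 2 ⟨
  sumFin {n * n} (λ _ → 2)
    ≤⟨ sumFin-mono (λ i → fits-1mod3⇒2≤b+2a (a i) (b i) (c i) n%3≡1 (fits i)) ⟩
  sumFin (λ i → b i + 2 * a i)       ≡⟨ ∑-distrib-+ b (λ i → 2 * a i) ⟩
  sumFin b + sumFin (λ i → 2 * a i)  ≡⟨ cong (sumFin b +_) (*-distribˡ-sum 2 a) ⟨
  sumFin b + 2 * sumFin a            ≡⟨ cong₂ (λ p q → p + 2 * q) Σb≡3C2 Σa≡n ⟩
  3 * (n C 2) + 2 * n                ∎)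
  where open ≤-Reasoning

fits-3⇒b≤a : ∀ a b c → a + 2 * b + 3 * c ≡ 3 → b ≤ a
fits-3⇒b≤a a       zero          c _    = z≤n
fits-3⇒b≤a (suc a) (suc zero)    c _    = s≤s z≤n
fits-3⇒b≤a zero    (suc zero)    c fits with m*n≡1⇒m≡1 3 c (suc-injective (suc-injective fits))
... | ()
fits-3⇒b≤a a       (suc (suc b)) c fits = ⊥-elim (<⇒≢ 3<lhs (sym fits))
  where
  3<lhs : 3 < a + 2 * (2 + b) + 3 * c
  3<lhs = ≤-trans (≤-trans (*-monoʳ-≤ 2 (m≤m+n 2 b)) (m≤n+m _ a)) (m≤m+n _ (3 * c))

solvable⇒≢3 : ∀ {n} → Solvable n → n ≢ 3
solvable⇒≢3 (a , b , c , fits , Σa≡3 , Σb≡9 , _) refl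
  with subst₂ _≤_ Σb≡9 Σa≡3 (sumFin-mono λ i → fits-3⇒b≤a (a i) (b i) (c i) (fits i))
... | s≤s (s≤s (s≤s ()))

weighted-column-sum : ∀ {n} (rs : List Row) → All (Fits n) rs →
  sum (map col₁ rs) + 2 * sum (map col₂ rs) + 3 * sum (map col₃ rs) ≡ length rs * n
weighted-column-sum []                 All.[]             = refl
weighted-column-sum {n} ((a , b , c) ∷ rs) (fits All.∷ fitss) = begin
  (a + s₁) + 2 * (b + s₂) + 3 * (c + s₃)        ≡⟨ regroup a b c s₁ s₂ s₃ ⟩
  (a + 2 * b + 3 * c) + (s₁ + 2 * s₂ + 3 * s₃)  ≡⟨ cong₂ _+_ fits (weighted-column-sum rs fitss) ⟩
  n + length rs * n                             ∎
  where
  s₁ = sum (map col₁ rs)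
  s₂ = sum (map col₂ rs)
  s₃ = sum (map col₃ rs)
  regroup : ∀ a b c s₁ s₂ s₃ →
    (a + s₁) + 2 * (b + s₂) + 3 * (c + s₃) ≡ (a + 2 * b + 3 * c) + (s₁ + 2 * s₂ + 3 * s₃)
  regroup = solve-∀
  open ≡-Reasoning

third-column-forced : ∀ n s₁ s₂ s₃ → s₁ ≡ n → s₂ ≡ 3 * (n C 2) →
  s₁ + 2 * s₂ + 3 * s₃ ≡ n * n * n → s₃ ≡ 2 * (n C 3)
third-column-forced n _ _ s₃ refl refl weighted-sum =
  *-cancelˡ-≡ s₃ _ 3 (+-cancelˡ-≡ (n + 2 * (3 * (n C 2))) _ _ (begin
    n + 2 * (3 * (n C 2)) + 3 * s₃            ≡⟨ weighted-sum ⟩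
    n * n * n                                 ≡⟨ n³≡n+6*nC2+6*nC3 n ⟩
    n + 6 * (n C 2) + 6 * (n C 3)
      ≡⟨ cong₂ (λ p q → n + p + q) (*-assoc 2 3 (n C 2)) (*-assoc 3 2 (n C 3)) ⟩
    n + 2 * (3 * (n C 2)) + 3 * (2 * (n C 3)) ∎))
  where open ≡-Reasoning

solvable-of-rows : ∀ {n} (rs : List Row) → length rs ≡ n * n → All (Fits n) rs →
  sum (map col₁ rs) ≡ n → sum (map col₂ rs) ≡ 3 * (n C 2) → Solvable n
solvable-of-rows {n} rs length≡ fits Σa≡n Σb≡3C2 = subst (Solution n) length≡
  ( col₁ ∘ lookup rs , col₂ ∘ lookup rs , col₃ ∘ lookup rs
  , (λ i → All.lookup fits (∈-lookup i))
  , trans (sumFin-lookup col₁ rs) Σa≡n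
  , trans (sumFin-lookup col₂ rs) Σb≡3C2
  , trans (sumFin-lookup col₃ rs) (third-column-forced n _ _ _ Σa≡n Σb≡3C2
      (trans (weighted-column-sum rs fits) (cong (_* n) length≡))))

Block : Set
Block = ℕ × Row

expand : List Block → List Row
expand []             = []
expand ((k , r) ∷ bs) = replicate k r ++ expand bs

size : List Block → ℕ
size bs = sum (map proj₁ bs)

total : (Row → ℕ) → List Block → ℕ
total f bs = sum (map (λ (k , r) → k * f r) bs)

length-expand : ∀ bs → length (expand bs) ≡ size bs
length-expand []             = refl
length-expand ((k , r) ∷ bs) = begin
  length (replicate k r ++ expand bs)          ≡⟨ length-++ (replicate k r) ⟩
  length (replicate k r) + length (expand bs)  ≡⟨ cong₂ _+_ (length-replicate k) (length-expand bs) ⟩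
  k + size bs                                  ∎
  where open ≡-Reasoning

sum-map-expand : ∀ f bs → sum (map f (expand bs)) ≡ total f bs
sum-map-expand f []             = refl
sum-map-expand f ((k , r) ∷ bs) = begin
  sum (map f (replicate k r ++ expand bs))               ≡⟨ cong sum (map-++ f (replicate k r) (expand bs)) ⟩
  sum (map f (replicate k r) ++ map f (expand bs))       ≡⟨ sum-++ (map f (replicate k r)) _ ⟩
  sum (map f (replicate k r)) + sum (map f (expand bs))  ≡⟨ cong (_+ _) (cong sum (map-replicate f k r)) ⟩
  sum (replicate k (f r)) + sum (map f (expand bs))      ≡⟨ cong₂ _+_ (sum-replicate k (f r)) (sum-map-expand f bs) ⟩
  k * f r + total f bs                                   ∎
  where open ≡-Reasoning

expand⁺ : ∀ {P : Row → Set} bs → All (P ∘ proj₂) bs → All P (expand bs)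
expand⁺ []             All.[]       = All.[]
expand⁺ ((k , _) ∷ bs) (p All.∷ ps) = ++⁺ (replicate⁺ k p) (expand⁺ bs ps)

solvable-of-blocks : ∀ {n} (bs : List Block) → size bs ≡ n * n → All (Fits n ∘ proj₂) bs →
  total col₁ bs ≡ n → total col₂ bs ≡ 3 * (n C 2) → Solvable n
solvable-of-blocks bs size≡ fits Σa≡n Σb≡3C2 = solvable-of-rows (expand bs)
  (trans (length-expand bs) size≡) (expand⁺ bs fits)
  (trans (sum-map-expand col₁ bs) Σa≡n) (trans (sum-map-expand col₂ bs) Σb≡3C2)

solvable-1 : Solvable 1
solvable-1 = solvable-of-blocks ((1 , 1 , 0 , 0) ∷ []) refl (refl All.∷ All.[]) refl refl

solvable-2 : Solvable 2
solvable-2 = solvable-of-blocks ((1 , 2 , 0 , 0) ∷ (3 , 0 , 1 , 0) ∷ [])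
  refl (refl All.∷ refl All.∷ All.[]) refl refl

solvable-5 : Solvable 5
solvable-5 = solvable-of-blocks ((5 , 1 , 2 , 0) ∷ (20 , 0 , 1 , 1) ∷ [])
  refl (refl All.∷ refl All.∷ All.[]) refl refl

-- The n rows (1, 1, 1 + k) carry the first column; the second column then forces
-- 6y = n(3n − 5).
solvable-6+k*3 : ∀ k y z → 2 * y ≡ (2 + k) * (13 + k * 9) →
  (6 + k * 3) * (6 + k * 3) ≡ 6 + k * 3 + (y + z) → Solvable (6 + k * 3)
solvable-6+k*3 k y z 2y≡ rows≡ = solvable-of-blocks {6 + k * 3}
  ((6 + k * 3 , 1 , 1 , 1 + k) ∷ (y , 0 , 3 , k) ∷ (z , 0 , 0 , 2 + k) ∷ [])
  (trans (cong (λ t → 6 + k * 3 + (y + t)) (+-identityʳ z)) (sym rows≡))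
  (solve (k ∷ []) All.∷ solve (k ∷ []) All.∷ solve (k ∷ []) All.∷ All.[])
  Σa≡n
  (2*X≡3*[1+m]*m⇒X≡3*[1+m]C2 (5 + k * 3) _ (begin
    2 * ((6 + k * 3) * 1 + (y * 3 + (z * 0 + 0)))   ≡⟨ solve (k ∷ y ∷ z ∷ []) ⟩
    2 * (6 + k * 3) + 3 * (2 * y)                   ≡⟨ cong (λ t → 2 * (6 + k * 3) + 3 * t) 2y≡ ⟩
    2 * (6 + k * 3) + 3 * ((2 + k) * (13 + k * 9))  ≡⟨ solve (k ∷ []) ⟩
    3 * ((6 + k * 3) * (5 + k * 3))                 ∎))
  where
  Σa≡n : (6 + k * 3) * 1 + (y * 0 + (z * 0 + 0)) ≡ 6 + k * 3
  Σa≡n = solve (k ∷ y ∷ z ∷ [])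
  open ≡-Reasoning

-- The n rows (1, 2, 1 + k) carry the first column; the second column then forces
-- 6y = n(n − 5).
solvable-8+k*3 : ∀ k y z → 2 * y ≡ (8 + k * 3) * suc k →
  (8 + k * 3) * (8 + k * 3) ≡ 8 + k * 3 + (y + z) → Solvable (8 + k * 3)
solvable-8+k*3 k y z 2y≡ rows≡ = solvable-of-blocks {8 + k * 3}
  ((8 + k * 3 , 1 , 2 , 1 + k) ∷ (y , 0 , 4 , k) ∷ (z , 0 , 1 , 2 + k) ∷ [])
  (trans (cong (λ t → 8 + k * 3 + (y + t)) (+-identityʳ z)) (sym rows≡))
  (solve (k ∷ []) All.∷ solve (k ∷ []) All.∷ solve (k ∷ []) All.∷ All.[])
  Σa≡n
  (2*X≡3*[1+m]*m⇒X≡3*[1+m]C2 (7 + k * 3) _ (begin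
    2 * ((8 + k * 3) * 2 + (y * 4 + (z * 1 + 0)))               ≡⟨ solve (k ∷ y ∷ z ∷ []) ⟩
    2 * (8 + k * 3) + 3 * (2 * y) + 2 * (8 + k * 3 + (y + z))
      ≡⟨ cong₂ (λ p q → 2 * (8 + k * 3) + 3 * p + 2 * q) 2y≡ (sym rows≡) ⟩
    2 * (8 + k * 3) + 3 * ((8 + k * 3) * suc k) + 2 * ((8 + k * 3) * (8 + k * 3))
      ≡⟨ solve (k ∷ []) ⟩
    3 * ((8 + k * 3) * (7 + k * 3))                             ∎))
  where
  Σa≡n : (8 + k * 3) * 1 + (y * 0 + (z * 0 + 0)) ≡ 8 + k * 3
  Σa≡n = solve (k ∷ y ∷ z ∷ [])
  open ≡-Reasoning

data Parity : ℕ → Set where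
  even : ∀ s → Parity (s * 2)
  odd  : ∀ s → Parity (1 + s * 2)

parity : ∀ k → Parity k
parity zero = even 0
parity (suc k) with parity k
... | even s = odd s
... | odd  s = even (suc s)

solvable-0mod3 : ∀ k → Solvable (6 + k * 3)
solvable-0mod3 k with parity k
... | even s = solvable-6+k*3 (s * 2) ((1 + s) * (13 + s * 18)) ((1 + s) * (17 + s * 18))
                 (solve (s ∷ [])) (solve (s ∷ []))
... | odd  s = solvable-6+k*3 (1 + s * 2) ((3 + s * 2) * (11 + s * 9)) ((3 + s * 2) * (13 + s * 9))
                 (solve (s ∷ [])) (solve (s ∷ []))

solvable-2mod3 : ∀ k → Solvable (8 + k * 3)
solvable-2mod3 k with parity k
... | even s = solvable-8+k*3 (s * 2) ((4 + s * 3) * (1 + s * 2)) ((4 + s * 3) * (13 + s * 10))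
                 (solve (s ∷ [])) (solve (s ∷ []))
... | odd  s = solvable-8+k*3 (1 + s * 2) ((11 + s * 6) * (1 + s)) ((11 + s * 6) * (9 + s * 5))
                 (solve (s ∷ [])) (solve (s ∷ []))

Admissible : ℕ → Set
Admissible n = n ≡ 1 ⊎ ((n % 3 ≡ 0 ⊎ n % 3 ≡ 2) × n ≢ 3)

n%3≡0∨1∨2 : ∀ n → n % 3 ≡ 0 ⊎ n % 3 ≡ 1 ⊎ n % 3 ≡ 2
n%3≡0∨1∨2 n with n % 3 | m%n<n n 3
... | 0                 | _ = inj₁ refl
... | 1                 | _ = inj₂ (inj₁ refl)
... | 2                 | _ = inj₂ (inj₂ refl)
... | suc (suc (suc _)) | s≤s (s≤s (s≤s ()))

n%3≡r⇒n≡r+[n/3]*3 : ∀ n {r} → n % 3 ≡ r → n ≡ r + n / 3 * 3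
n%3≡r⇒n≡r+[n/3]*3 n n%3≡r = trans (m≡m%n+[m/n]*n n 3) (cong (_+ n / 3 * 3) n%3≡r)

solvable⇒admissible : ∀ n → .{{NonZero n}} → Solvable n → Admissible n
solvable⇒admissible n sol with n%3≡0∨1∨2 n
... | inj₁ n%3≡0        = inj₂ (inj₁ n%3≡0 , solvable⇒≢3 sol)
... | inj₂ (inj₁ n%3≡1) = inj₁ (≤-antisym (solvable∧1mod3⇒n≤1 n n%3≡1 sol) (>-nonZero⁻¹ n))
... | inj₂ (inj₂ n%3≡2) = inj₂ (inj₂ n%3≡2 , solvable⇒≢3 sol)

admissible⇒solvable : ∀ n → .{{NonZero n}} → Admissible n → Solvable n
admissible⇒solvable n (inj₁ refl) = solvable-1
admissible⇒solvable n (inj₂ (inj₁ n%3≡0 , n≢3)) with n / 3 | n%3≡r⇒n≡r+[n/3]*3 n n%3≡0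
... | 0           | n≡0    = ⊥-elim (≢-nonZero⁻¹ n n≡0)
... | 1           | n≡3    = ⊥-elim (n≢3 n≡3)
... | suc (suc k) | n≡6+3k = subst Solvable (sym n≡6+3k) (solvable-0mod3 k)
admissible⇒solvable n (inj₂ (inj₂ n%3≡2 , _)) with n / 3 | n%3≡r⇒n≡r+[n/3]*3 n n%3≡2
... | 0           | n≡2    = subst Solvable (sym n≡2) solvable-2
... | 1           | n≡5    = subst Solvable (sym n≡5) solvable-5
... | suc (suc k) | n≡8+3k = subst Solvable (sym n≡8+3k) (solvable-2mod3 k)

lemma3p1 : (n : ℕ) → .{{_ : NonZero n}} →
    (Σ (Fin (n * n) → ℕ) λ a → Σ (Fin (n * n) → ℕ) λ b → Σ (Fin (n * n) → ℕ) λ c →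
       ((i : Fin (n * n)) → a i + 2 * b i + 3 * c i ≡ n)
       × sumFin a ≡ n
       × sumFin b ≡ 3 * (n C 2)
       × sumFin c ≡ 2 * (n C 3))
    ⇔ (n ≡ 1 ⊎ ((n % 3 ≡ 0 ⊎ n % 3 ≡ 2) × n ≢ 3))
lemma3p1 n = mk⇔ (solvable⇒admissible n) (admissible⇒solvable n)
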